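{- Let $N$ be a normalized DNF with support size $k$ that is a weakening of $M_1=\bigvee_{j\in[n]\setminus\{1\}}x_{j,1}$ (i.e. $M_1$ implies $N$), and let $R$ be the set of total orders rejected by $N$. Then: (1) $\tilde{\mathbb{E}}[N]\ge0$ if and only if $N$ has at least $k!$ terms; (2) letting $S_i$ denote the set of total orders accepted by exactly $i$ terms of $N$, $\tilde{\mathbb{E}}[N]\ge0$ if and only if $|R|\le\sum_{i\ge2}(i-1)|S_i|$.
   Context: Variables $x_{i,j}$, $i,j\in[n]$. A total order on $[n]$ is identified with the assignment $x_{i,j}=1$ iff $i$ precedes $j$; a formula accepts (rejects) a total order if this assignment satisfies (falsifies) it. Let $\mathrm{Ord}$ be the set of total orders. Terms are identified with polynomials ($\prod$ of $x_{i,j}$ for positive and $(1-x_{i,j})$ for negated literals), a DNF $D=\bigvee_{t\in D}t$ with $\sum_{t\in D}t-1$, and $\tilde{\mathbb{E}}[p]=\frac{1}{|\mathrm{Ord}|}\sum_{z\in\mathrm{Ord}}p(z)$, extended linearly. For $S\subseteq[n]$, $|S|\ge2$, and a bijection $\pi:[|S|]\to S$, $[\![S]\!]_\pi$ is the term $x_{\pi(1),\pi(2)}\cdots x_{\pi(|S|-1),\pi(|S|)}$ (support $S$). A DNF is normalized if every term is $[\![S]\!]_\pi$ for some $S\ni1$ and all terms have the same support size $|S|$ (the support size of the DNF). -}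

module Defs where

open import Data.Bool using (Bool; true; false; if_then_else_; not; _∧_)
open import Data.Nat as ℕ using (ℕ; zero; suc; _∸_; _≡ᵇ_)
open import Data.Fin as Fin using (Fin)
open import Data.Integer as ℤ using (ℤ)
open import Data.Rational as ℚ using (ℚ)
open import Data.List using (List; []; _∷_; [_]; map; concatMap; allFin; filter; filterᵇ; length; foldr; upTo; drop)
open import Data.Bool.ListAction using (any)
open import Data.List.Membership.Propositional using (_∈_)
open import Data.List.Relation.Unary.All using (All)
open import Data.Product using (_×_)
open import Relation.Nullary using (does; ¬?)
open import Relation.Binary.PropositionalEquality using (_≡_)
import Data.List.Relation.Unary.Unique.Propositional as UP
import Data.List.Relation.Unary.Unique.DecPropositional as UD

-- [n] is modelled by Fin n; the element "1" of [n] is Fin.zero (so n = suc m).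

Unique : ∀ {a} {A : Set a} → List A → Set a
Unique = UP.Unique

allLists : (n k : ℕ) → List (List (Fin n))
allLists n zero = [ [] ]
allLists n (suc k) = concatMap (λ a → map (a ∷_) (allLists n k)) (allFin n)

-- A total order on [n] is given by listing the elements of [n] from first to last
-- (a duplicate-free list of length n).  Ord n enumerates all total orders.
Order : ℕ → Set
Order n = List (Fin n)

Ord : (n : ℕ) → List (Order n)
Ord n = filter (UD.unique? Fin._≟_) (allLists n n)

precedes : ∀ {n} → Fin n → Fin n → Order n → Bool
precedes i j [] = false
precedes i j (a ∷ z) = if does (a Fin.≟ i) then any (λ b → does (b Fin.≟ j)) z else precedes i j z

x : ∀ {n} → Fin n → Fin n → Order n → ℤ
x i j z = if precedes i j z then ℤ.1ℤ else ℤ.0ℤ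

-- A term [[S]]_π is represented by the sequence π(1), …, π(|S|);
-- it is the conjunction x_{π(1),π(2)} ∧ … ∧ x_{π(|S|-1),π(|S|)}.
Term : ℕ → Set
Term n = List (Fin n)

DNF : ℕ → Set
DNF n = List (Term n)

acceptsTerm : ∀ {n} → Term n → Order n → Bool
acceptsTerm (a ∷ b ∷ t) z = precedes a b z ∧ acceptsTerm (b ∷ t) z
acceptsTerm _ z = true

accepts : ∀ {n} → DNF n → Order n → Bool
accepts D z = any (λ t → acceptsTerm t z) D

termPoly : ∀ {n} → Term n → Order n → ℤ
termPoly (a ∷ b ∷ t) z = x a b z ℤ.* termPoly (b ∷ t) z
termPoly _ z = ℤ.1ℤ

sumℤ : List ℤ → ℤ
sumℤ = foldr ℤ._+_ ℤ.0ℤ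

dnfPoly : ∀ {n} → DNF n → Order n → ℤ
dnfPoly D z = sumℤ (map (λ t → termPoly t z) D) ℤ.- ℤ.1ℤ

avg : List ℤ → ℚ
avg [] = ℚ.0ℚ
avg (v ∷ vs) = sumℤ (v ∷ vs) ℚ./ length (v ∷ vs)

Ẽ : ∀ {n} → (Order n → ℤ) → ℚ
Ẽ {n} p = avg (map p (Ord n))

-- M_1 = ⋁_{j ∈ [n] ∖ {1}} x_{j,1}, each x_{j,1} being the term [[{j,1}]]_(j,1)
M₁ : (m : ℕ) → DNF (suc m)
M₁ m = map (λ j → j ∷ Fin.zero ∷ []) (filter (λ j → ¬? (j Fin.≟ Fin.zero)) (allFin (suc m)))

Implies : ∀ {n} → DNF n → DNF n → Set
Implies {n} M N = ∀ z → z ∈ Ord n → accepts M z ≡ true → accepts N z ≡ true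

-- N is a normalized DNF with support size k: N is a set of terms (no repeats),
-- each term is [[S]]_π with 1 ∈ S, |S| = k ≥ 2, π a bijection [k] → S
-- (i.e. the sequence has length k, has no repeats, and contains 1).
Normalized : (m k : ℕ) → DNF (suc m) → Set
Normalized m k N = (2 ℕ.≤ k) × Unique N × All (λ t → length t ≡ k × Unique t × Fin.zero ∈ t) N

rejected : ∀ {n} → DNF n → List (Order n)
rejected {n} N = filterᵇ (λ z → not (accepts N z)) (Ord n)

numAccepting : ∀ {n} → DNF n → Order n → ℕ
numAccepting N z = length (filterᵇ (λ t → acceptsTerm t z) N)

S : ∀ {n} → DNF n → ℕ → List (Order n)
S {n} N i = filterᵇ (λ z → numAccepting N z ≡ᵇ i) (Ord n)

sumℕ : List ℕ → ℕ
sumℕ = foldr ℕ._+_ 0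

-- Σ_{i ≥ 2} (i−1)|S_i|; S_i is empty for i > |N|, so i ranges over 2..|N|
weightedSum : ∀ {n} → DNF n → ℕ
weightedSum N = sumℕ (map (λ i → (i ∸ 1) ℕ.* length (S N i)) (drop 2 (upTo (suc (length N)))))

-- Each term of a normalized DNF with support size k is a chain of k distinct elements, and the
-- k! relative orders of these elements are equally frequent among the n! total orders, so each
-- term accepts exactly n!/k! orders. Hence Ẽ[N] = |N|/k! − 1, which gives (1); for (2), summing
-- (number of accepting terms − 1) over all orders gives Σ_{i≥2} (i−1)|S_i| − |R|.
--
-- The count n!/k! comes from building an order from left to right: when the elements of Y are
-- placed and L positions remain, a duplicate-free term t avoiding Y accepts L!/|t|! of the
-- continuations. The induction on L splits on the next element: the head of t (which is then
-- dropped from t), an element of the tail of t (t rejects), or an element outside t (nothing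
-- changes).
module Submission where

open import Defs
import Algebra.Properties.CommutativeSemigroup as CommutativeSemigroupProperties
open import Data.Bool using (Bool; true; false; not; _∧_; _∨_; if_then_else_)
open import Data.Bool.ListAction using (any)
open import Data.Bool.Properties
  using (∧-conicalˡ; ∧-conicalʳ; ∧-zeroʳ; ∧-identityʳ; ∨-zeroʳ; ∨-conicalˡ; not-injective)
open import Data.Fin using (Fin; zero; suc; _≟_)
open import Data.Integer as ℤ using (ℤ; 0ℤ; 1ℤ; +≤+)
import Data.Integer.Properties as ℤ
open import Data.Integer.Tactic.RingSolver using (solve-∀)
open import Data.List
  using (List; []; _∷_; _++_; map; concatMap; filter; filterᵇ; length; upTo; drop; allFin)
open import Data.List.Membership.Propositional.Properties using (∈-allFin)
open import Data.List.Properties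
  using (map-cong; map-∘; map-++; map-applyUpTo; map-tabulate; length-tabulate; length-map; length-filter)
open import Data.List.Relation.Unary.All as All using (All; []; _∷_; all?)
open import Data.List.Relation.Unary.Unique.DecPropositional using (unique?)
open import Data.Nat using (ℕ; zero; suc; _+_; _*_; _∸_; _≤_; _<_; _≡ᵇ_; _!; z≤n; s≤s; NonZero)
open import Data.Nat.ListAction.Properties using (sum-++)
open import Data.Nat.Properties
  using ( +-commutativeSemigroup; +-identityʳ; +-suc; +-cancelˡ-≡; +-cancelˡ-≤; +-cancelʳ-≤
        ; +-monoˡ-≤; +-monoʳ-≤; *-comm; *-assoc; *-identityˡ; *-identityʳ; *-zeroʳ
        ; *-distribˡ-+; *-distribʳ-+; *-cancelˡ-≤; *-cancelʳ-≤; *-monoˡ-≤; *-monoʳ-≤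
        ; m≤n⇒m≤1+n; <⇒≢; suc-injective; _!≢0; 1≤n!)
open import Data.Product using (_×_; _,_)
open import Data.Rational as ℚ using (0ℚ; normalize)
import Data.Rational.Properties as ℚ
open import Function using (_∘_)
open import Function.Bundles using (_⇔_; mk⇔)
open import Function.Construct.Composition using (_⇔-∘_)
open import Level using (0ℓ)
open import Relation.Binary.PropositionalEquality
  using (_≡_; refl; sym; trans; cong; cong₂; subst; subst₂; module ≡-Reasoning)
open import Relation.Nullary using (does; yes; no; ¬?; contradiction)
open import Relation.Nullary.Decidable using (dec-true)
open import Relation.Unary using (Pred; Decidable)

open CommutativeSemigroupProperties +-commutativeSemigroup using (interchange; x∙yz≈y∙xz; x∙yz≈z∙xy)

private
  variable
    A B : Set

-- Sums and counts over lists

𝟙 : Bool → ℕ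
𝟙 true = 1
𝟙 false = 0

count : (A → Bool) → List A → ℕ
count p xs = sumℕ (map (𝟙 ∘ p) xs)

sum-map-cong : {f g : A → ℕ} → (∀ a → f a ≡ g a) → (xs : List A) →
  sumℕ (map f xs) ≡ sumℕ (map g xs)
sum-map-cong f≗g xs = cong sumℕ (map-cong f≗g xs)

sum-map-zero : {f : A → ℕ} → (∀ a → f a ≡ 0) → (xs : List A) → sumℕ (map f xs) ≡ 0
sum-map-zero f≗0 [] = refl
sum-map-zero f≗0 (x ∷ xs) = cong₂ _+_ (f≗0 x) (sum-map-zero f≗0 xs)

sum-map-+ : (f g : A → ℕ) (xs : List A) →
  sumℕ (map (λ a → f a + g a) xs) ≡ sumℕ (map f xs) + sumℕ (map g xs)
sum-map-+ f g [] = refl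
sum-map-+ f g (x ∷ xs) = trans (cong (f x + g x +_) (sum-map-+ f g xs)) (interchange (f x) (g x) _ _)

sum-map-suc : (f : A → ℕ) (xs : List A) → sumℕ (map (suc ∘ f) xs) ≡ length xs + sumℕ (map f xs)
sum-map-suc f [] = refl
sum-map-suc f (x ∷ xs) =
  cong suc (trans (cong (f x +_) (sum-map-suc f xs)) (x∙yz≈y∙xz (f x) (length xs) _))

*-distribˡ-sum-map : (c : ℕ) (f : A → ℕ) (xs : List A) →
  c * sumℕ (map f xs) ≡ sumℕ (map (λ a → c * f a) xs)
*-distribˡ-sum-map c f [] = *-zeroʳ c
*-distribˡ-sum-map c f (x ∷ xs) =
  trans (*-distribˡ-+ c (f x) _) (cong (c * f x +_) (*-distribˡ-sum-map c f xs))

*-distribʳ-sum-map : (c : ℕ) (f : A → ℕ) (xs : List A) →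
  sumℕ (map f xs) * c ≡ sumℕ (map (λ a → f a * c) xs)
*-distribʳ-sum-map c f xs = trans (*-comm _ c)
  (trans (*-distribˡ-sum-map c f xs) (sum-map-cong (λ a → *-comm c (f a)) xs))

*-sum-map-uniform : (c d : ℕ) (f : A → ℕ) (xs : List A) → All (λ a → c * f a ≡ d) xs →
  c * sumℕ (map f xs) ≡ length xs * d
*-sum-map-uniform c d f [] [] = *-zeroʳ c
*-sum-map-uniform c d f (x ∷ xs) (cfx≡d ∷ cf≡d) =
  trans (*-distribˡ-+ c (f x) _) (cong₂ _+_ cfx≡d (*-sum-map-uniform c d f xs cf≡d))

sum-map-swap : (f : A → B → ℕ) (xs : List A) (ys : List B) →
  sumℕ (map (λ a → sumℕ (map (f a) ys)) xs) ≡ sumℕ (map (λ b → sumℕ (map (λ a → f a b) xs)) ys)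
sum-map-swap f [] ys = sym (sum-map-zero (λ _ → refl) ys)
sum-map-swap f (x ∷ xs) ys = trans (cong (sumℕ (map (f x) ys) +_) (sum-map-swap f xs ys))
  (sym (sum-map-+ (f x) (λ b → sumℕ (map (λ a → f a b) xs)) ys))

count-none : {p : A → Bool} → (∀ a → p a ≡ false) → (xs : List A) → count p xs ≡ 0
count-none p≗false = sum-map-zero (λ a → cong 𝟙 (p≗false a))

count-cong : {p q : A → Bool} → (∀ a → p a ≡ q a) → (xs : List A) → count p xs ≡ count q xs
count-cong p≗q = sum-map-cong (λ a → cong 𝟙 (p≗q a))

count-++ : (p : A → Bool) (xs ys : List A) → count p (xs ++ ys) ≡ count p xs + count p ys
count-++ p xs ys = trans (cong sumℕ (map-++ (𝟙 ∘ p) xs ys)) (sum-++ (map (𝟙 ∘ p) xs) _)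

count-map : (p : B → Bool) (f : A → B) (xs : List A) → count p (map f xs) ≡ count (p ∘ f) xs
count-map p f xs = cong sumℕ (sym (map-∘ xs))

count-concatMap : (p : B → Bool) (f : A → List B) (xs : List A) →
  count p (concatMap f xs) ≡ sumℕ (map (count p ∘ f) xs)
count-concatMap p f [] = refl
count-concatMap p f (x ∷ xs) =
  trans (count-++ p (f x) (concatMap f xs)) (cong (count p (f x) +_) (count-concatMap p f xs))

count-filter : {P : Pred A 0ℓ} (P? : Decidable P) (p : A → Bool) (xs : List A) →
  count p (filter P? xs) ≡ count (λ a → does (P? a) ∧ p a) xs
count-filter P? p [] = refl
count-filter P? p (x ∷ xs) with does (P? x)
... | true = cong (𝟙 (p x) +_) (count-filter P? p xs)
... | false = count-filter P? p xs

length-filter≡count : {P : Pred A 0ℓ} (P? : Decidable P) (xs : List A) →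
  length (filter P? xs) ≡ count (does ∘ P?) xs
length-filter≡count P? [] = refl
length-filter≡count P? (x ∷ xs) with does (P? x)
... | true = cong suc (length-filter≡count P? xs)
... | false = length-filter≡count P? xs

length-filterᵇ : (p : A → Bool) (xs : List A) → length (filterᵇ p xs) ≡ count p xs
length-filterᵇ p = length-filter≡count _

count≤length : (p : A → Bool) (xs : List A) → count p xs ≤ length xs
count≤length p [] = z≤n
count≤length p (x ∷ xs) with p x
... | true = s≤s (count≤length p xs)
... | false = m≤n⇒m≤1+n (count≤length p xs)

count-not+count : (p : A → Bool) (xs : List A) → count (not ∘ p) xs + count p xs ≡ length xs
count-not+count p [] = refl
count-not+count p (x ∷ xs) with p x
... | true = trans (+-suc _ _) (cong suc (count-not+count p xs))
... | false = cong suc (count-not+count p xs)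

count-∨ : (p q : A → Bool) (xs : List A) → (∀ a → p a ≡ true → q a ≡ false) →
  count (λ a → p a ∨ q a) xs ≡ count p xs + count q xs
count-∨ p q [] _ = refl
count-∨ p q (x ∷ xs) p⇒¬q with p x in px
... | true rewrite p⇒¬q x px = cong suc (count-∨ p q xs p⇒¬q)
... | false = trans (cong (𝟙 (q x) +_) (count-∨ p q xs p⇒¬q))
                   (x∙yz≈y∙xz (𝟙 (q x)) (count p xs) (count q xs))

count≡length⇒all : (p : A → Bool) (xs : List A) → count p xs ≡ length xs →
  All (λ a → p a ≡ true) xs
count≡length⇒all p [] _ = []
count≡length⇒all p (x ∷ xs) eq with p x in px
... | true = px ∷ count≡length⇒all p xs (suc-injective eq)
... | false = contradiction eq (<⇒≢ (s≤s (count≤length p xs)))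

not-any≡length-filterᵇ≡ᵇ0 : (p : A → Bool) (xs : List A) →
  not (any p xs) ≡ (length (filterᵇ p xs) ≡ᵇ 0)
not-any≡length-filterᵇ≡ᵇ0 p [] = refl
not-any≡length-filterᵇ≡ᵇ0 p (x ∷ xs) with p x
... | true = refl
... | false = not-any≡length-filterᵇ≡ᵇ0 p xs

sum-map-upTo-suc : (h : ℕ → ℕ) (K : ℕ) →
  sumℕ (map h (upTo (suc K))) ≡ h 0 + sumℕ (map (h ∘ suc) (upTo K))
sum-map-upTo-suc h K =
  cong (λ l → h 0 + sumℕ l) (trans (map-applyUpTo suc h K) (sym (map-applyUpTo (λ i → i) (h ∘ suc) K)))

sum-upTo-select : (g : ℕ → ℕ) {v K : ℕ} → v < K →
  sumℕ (map (λ i → g i * 𝟙 (v ≡ᵇ i)) (upTo K)) ≡ g v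
sum-upTo-select g {zero} {suc K} _ = trans (sum-map-upTo-suc _ K) (trans
  (cong₂ _+_ (*-identityʳ (g 0)) (sum-map-zero (λ i → *-zeroʳ (g (suc i))) (upTo K))) (+-identityʳ (g 0)))
sum-upTo-select g {suc v} {suc K} (s≤s v<K) =
  trans (sum-map-upTo-suc _ K) (cong₂ _+_ (*-zeroʳ (g 0)) (sum-upTo-select (g ∘ suc) v<K))

sum-map-by-value : (g : ℕ → ℕ) (f : A → ℕ) (M : ℕ) (xs : List A) → (∀ a → f a ≤ M) →
  sumℕ (map (g ∘ f) xs) ≡ sumℕ (map (λ i → g i * count (λ a → f a ≡ᵇ i) xs) (upTo (suc M)))
sum-map-by-value g f M xs f≤M = begin
  sumℕ (map (g ∘ f) xs)
    ≡⟨ sum-map-cong (λ a → sym (sum-upTo-select g (s≤s (f≤M a)))) xs ⟩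
  sumℕ (map (λ a → sumℕ (map (λ i → g i * 𝟙 (f a ≡ᵇ i)) (upTo (suc M)))) xs)
    ≡⟨ sum-map-swap (λ a i → g i * 𝟙 (f a ≡ᵇ i)) xs (upTo (suc M)) ⟩
  sumℕ (map (λ i → sumℕ (map (λ a → g i * 𝟙 (f a ≡ᵇ i)) xs)) (upTo (suc M)))
    ≡⟨ sum-map-cong (λ i → sym (*-distribˡ-sum-map (g i) (λ a → 𝟙 (f a ≡ᵇ i)) xs)) (upTo (suc M)) ⟩
  sumℕ (map (λ i → g i * count (λ a → f a ≡ᵇ i) xs) (upTo (suc M)))
    ∎
  where open ≡-Reasoning

-- Truncated subtraction drops the −1 of an order with v = 0; the indicator restores it.
n+𝟙[n≡0]≡1+[n∸1] : ∀ v → v + 𝟙 (v ≡ᵇ 0) ≡ suc (v ∸ 1)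
n+𝟙[n≡0]≡1+[n∸1] zero = refl
n+𝟙[n≡0]≡1+[n∸1] (suc v) = +-identityʳ (suc v)

sum+zeros≡length+excess : (f : A → ℕ) (M : ℕ) (xs : List A) → (∀ a → f a ≤ M) →
  sumℕ (map f xs) + count (λ a → f a ≡ᵇ 0) xs
    ≡ length xs + sumℕ (map (λ i → (i ∸ 1) * count (λ a → f a ≡ᵇ i) xs) (upTo (suc M)))
sum+zeros≡length+excess f M xs f≤M = begin
  sumℕ (map f xs) + count (λ a → f a ≡ᵇ 0) xs
    ≡⟨ sum-map-+ f (λ a → 𝟙 (f a ≡ᵇ 0)) xs ⟨
  sumℕ (map (λ a → f a + 𝟙 (f a ≡ᵇ 0)) xs)
    ≡⟨ sum-map-cong (λ a → n+𝟙[n≡0]≡1+[n∸1] (f a)) xs ⟩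
  sumℕ (map (λ a → suc (f a ∸ 1)) xs)
    ≡⟨ sum-map-suc (λ a → f a ∸ 1) xs ⟩
  length xs + sumℕ (map (λ a → f a ∸ 1) xs)
    ≡⟨ cong (length xs +_) (sum-map-by-value (_∸ 1) f M xs f≤M) ⟩
  length xs + sumℕ (map (λ i → (i ∸ 1) * count (λ a → f a ≡ᵇ i) xs) (upTo (suc M)))
    ∎
  where open ≡-Reasoning

sum-drop-2-upTo : (c : ℕ → ℕ) (M : ℕ) →
  sumℕ (map (λ i → (i ∸ 1) * c i) (drop 2 (upTo (suc M))))
    ≡ sumℕ (map (λ i → (i ∸ 1) * c i) (upTo (suc M)))
sum-drop-2-upTo c zero = refl
sum-drop-2-upTo c (suc M) = refl

count-allFin-suc : ∀ {n} (p : Fin (suc n) → Bool) →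
  count p (allFin (suc n)) ≡ 𝟙 (p zero) + count (p ∘ suc) (allFin n)
count-allFin-suc {n} p =
  cong (𝟙 (p zero) +_)
    (trans (cong (count p) (sym (map-tabulate (λ i → i) suc))) (count-map p suc (allFin n)))

count-≟-allFin : ∀ {n} (w : Fin n) → count (λ e → does (w ≟ e)) (allFin n) ≡ 1
count-≟-allFin {suc n} zero =
  trans (count-allFin-suc {n} (λ e → does (zero ≟ e))) (cong suc (count-none (λ _ → refl) (allFin n)))
count-≟-allFin {suc n} (suc w) = trans (count-allFin-suc {n} (λ e → does (suc w ≟ e))) (count-≟-allFin w)

module _ {n : ℕ} where

  ≟⇒≡ : {a b : Fin n} → does (a ≟ b) ≡ true → a ≡ b
  ≟⇒≡ {a} {b} a≟b with a ≟ b
  ≟⇒≡ _ | yes a≡b = a≡b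
  ≟⇒≡ () | no _

  ≟-refl : (a : Fin n) → does (a ≟ a) ≡ true
  ≟-refl a = dec-true (a ≟ a) refl

  ≟-sym : (a b : Fin n) → does (a ≟ b) ≡ does (b ≟ a)
  ≟-sym a b with a ≟ b | b ≟ a
  ... | yes _ | yes _ = refl
  ... | no _ | no _ = refl
  ... | yes a≡b | no b≢a = contradiction (sym a≡b) b≢a
  ... | no a≢b | yes b≡a = contradiction (sym b≡a) a≢b

  -- Membership in exactly the form used by `precedes`.
  infix 8 _∈ᵇ_
  _∈ᵇ_ : Fin n → List (Fin n) → Bool
  j ∈ᵇ z = any (λ b → does (b ≟ j)) z

  uniqueᵇ : List (Fin n) → Bool
  uniqueᵇ z = does (unique? _≟_ z)

  disjointᵇ : List (Fin n) → List (Fin n) → Bool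
  disjointᵇ z [] = true
  disjointᵇ z (y ∷ Y) = not (y ∈ᵇ z) ∧ disjointᵇ z Y

  isHead : Fin n → List (Fin n) → Bool
  isHead a [] = false
  isHead a (h ∷ _) = does (h ≟ a)

  ∈ᵇ-head : (j : Fin n) (r : List (Fin n)) → j ∈ᵇ (j ∷ r) ≡ true
  ∈ᵇ-head j r rewrite ≟-refl j = refl

  ∉ᵇ⇒¬isHead : (a : Fin n) (t : List (Fin n)) → a ∈ᵇ t ≡ false → isHead a t ≡ false
  ∉ᵇ⇒¬isHead a [] _ = refl
  ∉ᵇ⇒¬isHead a (h ∷ t) a∉t with does (h ≟ a)
  ... | false = refl

  all≢-does : (a : Fin n) (z : List (Fin n)) → does (all? (λ y → ¬? (a ≟ y)) z) ≡ not (a ∈ᵇ z)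
  all≢-does a [] = refl
  all≢-does a (y ∷ z) rewrite ≟-sym a y with does (y ≟ a)
  ... | true = refl
  ... | false = all≢-does a z

  uniqueᵇ-∷ : (a : Fin n) (z : List (Fin n)) → uniqueᵇ (a ∷ z) ≡ not (a ∈ᵇ z) ∧ uniqueᵇ z
  uniqueᵇ-∷ a z = cong (_∧ uniqueᵇ z) (all≢-does a z)

  uniqueᵇ-∷⇒∉ : (a : Fin n) (z : List (Fin n)) → uniqueᵇ (a ∷ z) ≡ true → a ∈ᵇ z ≡ false
  uniqueᵇ-∷⇒∉ a z uniq = not-injective (∧-conicalˡ _ _ (trans (sym (uniqueᵇ-∷ a z)) uniq))

  disjointᵇ-[]ˡ : (Y : List (Fin n)) → disjointᵇ [] Y ≡ true
  disjointᵇ-[]ˡ [] = refl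
  disjointᵇ-[]ˡ (y ∷ Y) = disjointᵇ-[]ˡ Y

  disjointᵇ-∷ˡ-∈ : (a : Fin n) (z Y : List (Fin n)) → a ∈ᵇ Y ≡ true → disjointᵇ (a ∷ z) Y ≡ false
  disjointᵇ-∷ˡ-∈ a z (y ∷ Y) a∈Y with does (y ≟ a) in y≟a
  ... | true rewrite trans (≟-sym a y) y≟a = refl
  ... | false rewrite disjointᵇ-∷ˡ-∈ a z Y a∈Y = ∧-zeroʳ _

  disjointᵇ-∷ˡ-∉ : (a : Fin n) (z Y : List (Fin n)) → a ∈ᵇ Y ≡ false →
    disjointᵇ (a ∷ z) Y ≡ disjointᵇ z Y
  disjointᵇ-∷ˡ-∉ a z [] _ = refl
  disjointᵇ-∷ˡ-∉ a z (y ∷ Y) a∉Y with does (y ≟ a) in y≟a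
  disjointᵇ-∷ˡ-∉ a z (y ∷ Y) () | true
  disjointᵇ-∷ˡ-∉ a z (y ∷ Y) a∉Y | false rewrite trans (≟-sym a y) y≟a =
    cong (not (y ∈ᵇ z) ∧_) (disjointᵇ-∷ˡ-∉ a z Y a∉Y)

  disjointᵇ⇒∉ʳ : (z Y : List (Fin n)) (y : Fin n) → disjointᵇ z Y ≡ true → y ∈ᵇ Y ≡ true →
    y ∈ᵇ z ≡ false
  disjointᵇ⇒∉ʳ z (c ∷ Y) y dis y∈Y with does (c ≟ y) in c≟y
  ... | true = subst (λ b → b ∈ᵇ z ≡ false) (≟⇒≡ c≟y) (not-injective (∧-conicalˡ _ _ dis))
  ... | false = disjointᵇ⇒∉ʳ z Y y (∧-conicalʳ _ _ dis) y∈Y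

  disjointᵇ⇒∉ˡ : (z Y : List (Fin n)) (x : Fin n) → disjointᵇ z Y ≡ true → x ∈ᵇ z ≡ true →
    x ∈ᵇ Y ≡ false
  disjointᵇ⇒∉ˡ z Y x dis x∈z with x ∈ᵇ Y in x∈Y
  ... | true = contradiction (trans (sym x∈z) (disjointᵇ⇒∉ʳ z Y x dis x∈Y)) λ ()
  ... | false = refl

  count-∈ᵇ-allFin : (W : List (Fin n)) → uniqueᵇ W ≡ true → count (_∈ᵇ W) (allFin n) ≡ length W
  count-∈ᵇ-allFin [] _ = count-none (λ _ → refl) (allFin n)
  count-∈ᵇ-allFin (w ∷ W) uniq =
    trans (count-∨ (λ e → does (w ≟ e)) (_∈ᵇ W) (allFin n) w≟⇒∉W)
          (cong₂ _+_ (count-≟-allFin w) (count-∈ᵇ-allFin W (∧-conicalʳ _ _ uniq)))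
    where
    w≟⇒∉W : ∀ e → does (w ≟ e) ≡ true → e ∈ᵇ W ≡ false
    w≟⇒∉W e w≟e = subst (λ b → b ∈ᵇ W ≡ false) (≟⇒≡ w≟e) (uniqueᵇ-∷⇒∉ w W uniq)

  count-∈ᵇ-∨-allFin : (U V : List (Fin n)) → uniqueᵇ U ≡ true → uniqueᵇ V ≡ true →
    disjointᵇ V U ≡ true → count (λ e → e ∈ᵇ U ∨ e ∈ᵇ V) (allFin n) ≡ length U + length V
  count-∈ᵇ-∨-allFin U V uniq-U uniq-V dis =
    trans (count-∨ (_∈ᵇ U) (_∈ᵇ V) (allFin n) (λ e → disjointᵇ⇒∉ʳ V U e dis))
          (cong₂ _+_ (count-∈ᵇ-allFin U uniq-U) (count-∈ᵇ-allFin V uniq-V))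

  count-∉ᵇ-∨-allFin+length : (U V : List (Fin n)) → uniqueᵇ U ≡ true → uniqueᵇ V ≡ true →
    disjointᵇ V U ≡ true → count (λ e → not (e ∈ᵇ U ∨ e ∈ᵇ V)) (allFin n) + (length U + length V) ≡ n
  count-∉ᵇ-∨-allFin+length U V uniq-U uniq-V dis =
    trans (cong (count (λ e → not (e ∈ᵇ U ∨ e ∈ᵇ V)) (allFin n) +_)
                (sym (count-∈ᵇ-∨-allFin U V uniq-U uniq-V dis)))
          (trans (count-not+count (λ e → e ∈ᵇ U ∨ e ∈ᵇ V) (allFin n)) (length-tabulate (λ i → i)))

  length+length≤n : (U V : List (Fin n)) → uniqueᵇ U ≡ true → uniqueᵇ V ≡ true →
    disjointᵇ V U ≡ true → length U + length V ≤ n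
  length+length≤n U V uniq-U uniq-V dis = subst₂ _≤_ (count-∈ᵇ-∨-allFin U V uniq-U uniq-V dis)
    (length-tabulate (λ i → i)) (count≤length (λ e → e ∈ᵇ U ∨ e ∈ᵇ V) (allFin n))

  ∉ᵇ⇒∈ᵇ-complement : (U V : List (Fin n)) (j : Fin n) → uniqueᵇ U ≡ true → uniqueᵇ V ≡ true →
    disjointᵇ V U ≡ true → length U + length V ≡ n → j ∈ᵇ U ≡ false → j ∈ᵇ V ≡ true
  ∉ᵇ⇒∈ᵇ-complement U V j uniq-U uniq-V dis full j∉U =
    trans (cong (_∨ j ∈ᵇ V) (sym j∉U)) (All.lookup everywhere (∈-allFin j))
    where
    everywhere : All (λ e → (e ∈ᵇ U ∨ e ∈ᵇ V) ≡ true) (allFin n)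
    everywhere = count≡length⇒all _ (allFin n)
      (trans (count-∈ᵇ-∨-allFin U V uniq-U uniq-V dis) (trans full (sym (length-tabulate (λ i → i)))))

  precedes⇒∈ᵇ : (i j : Fin n) (z : List (Fin n)) → precedes i j z ≡ true → j ∈ᵇ z ≡ true
  precedes⇒∈ᵇ i j (b ∷ z) i<j with does (b ≟ i)
  ... | true = trans (cong (does (b ≟ j) ∨_) i<j) (∨-zeroʳ _)
  ... | false = trans (cong (does (b ≟ j) ∨_) (precedes⇒∈ᵇ i j z i<j)) (∨-zeroʳ _)

  ∉ᵇ⇒¬precedes : (i j : Fin n) (z : List (Fin n)) → j ∈ᵇ z ≡ false → precedes i j z ≡ false
  ∉ᵇ⇒¬precedes i j z j∉z with precedes i j z in i<j
  ... | true = contradiction (trans (sym (precedes⇒∈ᵇ i j z i<j)) j∉z) λ ()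
  ... | false = refl

  precedes-∷-≢ : (a i j : Fin n) (z : List (Fin n)) → does (a ≟ i) ≡ false →
    precedes i j (a ∷ z) ≡ precedes i j z
  precedes-∷-≢ a i j z a≢i rewrite a≢i = refl

  acceptsTerm-∷-nonhead : (a : Fin n) (t z : List (Fin n)) → a ∈ᵇ z ≡ false → isHead a t ≡ false →
    acceptsTerm t (a ∷ z) ≡ acceptsTerm t z
  acceptsTerm-∷-nonhead a [] z _ _ = refl
  acceptsTerm-∷-nonhead a (i ∷ r) z a∉z i≢a = go i r i≢a
    where
    go : (i : Fin n) (r : List (Fin n)) → does (i ≟ a) ≡ false →
      acceptsTerm (i ∷ r) (a ∷ z) ≡ acceptsTerm (i ∷ r) z
    go i [] _ = refl
    go i (j ∷ r) i≢a with does (j ≟ a) in j≟a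
    ... | false = cong₂ _∧_ (precedes-∷-≢ a i j z (trans (≟-sym a i) i≢a)) (go j r j≟a)
    ... | true rewrite precedes-∷-≢ a i j z (trans (≟-sym a i) i≢a)
                     | ∉ᵇ⇒¬precedes i j z (subst (λ b → b ∈ᵇ z ≡ false) (sym (≟⇒≡ j≟a)) a∉z) = refl

  acceptsTerm-∷-head : (a j : Fin n) (r z : List (Fin n)) → a ∈ᵇ z ≡ false → does (j ≟ a) ≡ false →
    j ∈ᵇ z ≡ true → acceptsTerm (a ∷ j ∷ r) (a ∷ z) ≡ acceptsTerm (j ∷ r) z
  acceptsTerm-∷-head a j r z a∉z j≢a j∈z rewrite ≟-refl a | j∈z =
    acceptsTerm-∷-nonhead a (j ∷ r) z a∉z j≢a

  acceptsTerm⇒∈ᵇ : (h e : Fin n) (t z : List (Fin n)) → acceptsTerm (h ∷ t) z ≡ true → e ∈ᵇ t ≡ true →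
    e ∈ᵇ z ≡ true
  acceptsTerm⇒∈ᵇ h e (j ∷ r) z accepted e∈t with does (j ≟ e) in j≟e
  ... | true = subst (λ b → b ∈ᵇ z ≡ true) (≟⇒≡ j≟e) (precedes⇒∈ᵇ h j z (∧-conicalˡ _ _ accepted))
  ... | false = acceptsTerm⇒∈ᵇ j e r z (∧-conicalʳ _ _ accepted) e∈t

  -- Counting the orders accepted by a term

  count-allLists-suc : (p : List (Fin n) → Bool) (L : ℕ) →
    count p (allLists n (suc L)) ≡ sumℕ (map (λ a → count (p ∘ (a ∷_)) (allLists n L)) (allFin n))
  count-allLists-suc p L = trans (count-concatMap p _ (allFin n))
    (sum-map-cong (λ a → count-map p (a ∷_) (allLists n L)) (allFin n))

  count-allLists-cong : {p q : List (Fin n) → Bool} (L : ℕ) → (∀ z → length z ≡ L → p z ≡ q z) →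
    count p (allLists n L) ≡ count q (allLists n L)
  count-allLists-cong zero p≗q = cong (λ b → 𝟙 b + 0) (p≗q [] refl)
  count-allLists-cong {p} {q} (suc L) p≗q = begin
    count p (allLists n (suc L))
      ≡⟨ count-allLists-suc p L ⟩
    sumℕ (map (λ a → count (p ∘ (a ∷_)) (allLists n L)) (allFin n))
      ≡⟨ sum-map-cong (λ a → count-allLists-cong L (λ z ∣z∣≡L → p≗q (a ∷ z) (cong suc ∣z∣≡L)))
                      (allFin n) ⟩
    sumℕ (map (λ a → count (q ∘ (a ∷_)) (allLists n L)) (allFin n))
      ≡⟨ count-allLists-suc q L ⟨
    count q (allLists n (suc L))
      ∎
    where open ≡-Reasoning

  acceptedAvoidingᵇ : List (Fin n) → Term n → List (Fin n) → Bool
  acceptedAvoidingᵇ Y t z = uniqueᵇ z ∧ (disjointᵇ z Y ∧ acceptsTerm t z)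

  #acceptedAvoiding : List (Fin n) → ℕ → Term n → ℕ
  #acceptedAvoiding Y L t = count (acceptedAvoidingᵇ Y t) (allLists n L)

  acceptedAvoidingᵇ-∷-∈ : (a : Fin n) (Y t z : List (Fin n)) → a ∈ᵇ Y ≡ true →
    acceptedAvoidingᵇ Y t (a ∷ z) ≡ false
  acceptedAvoidingᵇ-∷-∈ a Y t z a∈Y rewrite disjointᵇ-∷ˡ-∈ a z Y a∈Y = ∧-zeroʳ _

  acceptedAvoidingᵇ-∷ : (a : Fin n) (Y t t′ z : List (Fin n)) → a ∈ᵇ Y ≡ false →
    (a ∈ᵇ z ≡ false → uniqueᵇ z ≡ true → disjointᵇ z Y ≡ true →
     acceptsTerm t (a ∷ z) ≡ acceptsTerm t′ z) →
    acceptedAvoidingᵇ Y t (a ∷ z) ≡ acceptedAvoidingᵇ (a ∷ Y) t′ z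
  acceptedAvoidingᵇ-∷ a Y t t′ z a∉Y moved rewrite uniqueᵇ-∷ a z | disjointᵇ-∷ˡ-∉ a z Y a∉Y
    with a ∈ᵇ z | uniqueᵇ z | disjointᵇ z Y
  ... | true | u | _ = sym (∧-zeroʳ u)
  ... | false | false | _ = refl
  ... | false | true | false = refl
  ... | false | true | true = moved refl refl refl

  acceptedAvoidingᵇ-∷-tail : (a h : Fin n) (Y t z : List (Fin n)) → a ∈ᵇ Y ≡ false →
    does (h ≟ a) ≡ false → a ∈ᵇ t ≡ true → acceptedAvoidingᵇ Y (h ∷ t) (a ∷ z) ≡ false
  acceptedAvoidingᵇ-∷-tail a h Y t z a∉Y h≢a a∈t = trans
    (acceptedAvoidingᵇ-∷ a Y (h ∷ t) (h ∷ t) z a∉Y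
      (λ a∉z _ _ → acceptsTerm-∷-nonhead a (h ∷ t) z a∉z h≢a))
    rejects
    where
    rejects : acceptedAvoidingᵇ (a ∷ Y) (h ∷ t) z ≡ false
    rejects with acceptsTerm (h ∷ t) z in accepted
    ... | true rewrite acceptsTerm⇒∈ᵇ h a t z accepted a∈t = ∧-zeroʳ (uniqueᵇ z)
    ... | false = trans (cong (uniqueᵇ z ∧_) (∧-zeroʳ _)) (∧-zeroʳ _)

  ArrangementCount : ℕ → Set
  ArrangementCount L = ∀ Y t → uniqueᵇ Y ≡ true → uniqueᵇ t ≡ true → disjointᵇ t Y ≡ true →
    length Y + L ≡ n → length t ! * #acceptedAvoiding Y L t ≡ L !

  module FirstElement {L : ℕ} (ih : ArrangementCount L) (Y : List (Fin n)) (uniq-Y : uniqueᵇ Y ≡ true)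
                      (len : length Y + suc L ≡ n) where

    #placedFirst : Term n → Fin n → ℕ
    #placedFirst t a = count (acceptedAvoidingᵇ Y t ∘ (a ∷_)) (allLists n L)

    uniq-∷Y : (a : Fin n) → a ∈ᵇ Y ≡ false → uniqueᵇ (a ∷ Y) ≡ true
    uniq-∷Y a a∉Y = trans (uniqueᵇ-∷ a Y) (cong₂ _∧_ (cong not a∉Y) uniq-Y)

    len-∷Y : (a : Fin n) → length (a ∷ Y) + L ≡ n
    len-∷Y _ = trans (sym (+-suc (length Y) L)) len

    #placedFirst-∈ : (a : Fin n) (t : Term n) → a ∈ᵇ Y ≡ true → length t ! * #placedFirst t a ≡ 0
    #placedFirst-∈ a t a∈Y = trans
      (cong (length t ! *_) (count-none (λ z → acceptedAvoidingᵇ-∷-∈ a Y t z a∈Y) (allLists n L)))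
      (*-zeroʳ (length t !))

    #placedFirst-tail : (a h : Fin n) (t : Term n) → a ∈ᵇ Y ≡ false → does (h ≟ a) ≡ false →
      a ∈ᵇ t ≡ true → length (h ∷ t) ! * #placedFirst (h ∷ t) a ≡ 0
    #placedFirst-tail a h t a∉Y h≢a a∈t = trans
      (cong (length (h ∷ t) ! *_)
        (count-none (λ z → acceptedAvoidingᵇ-∷-tail a h Y t z a∉Y h≢a a∈t) (allLists n L)))
      (*-zeroʳ (length (h ∷ t) !))

    #placedFirst-fresh : (a : Fin n) (t : Term n) → uniqueᵇ t ≡ true → disjointᵇ t Y ≡ true →
      a ∈ᵇ Y ≡ false → a ∈ᵇ t ≡ false → length t ! * #placedFirst t a ≡ L !
    #placedFirst-fresh a t uniq-t t-avoids-Y a∉Y a∉t = trans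
      (cong (length t ! *_) (count-cong (λ z → acceptedAvoidingᵇ-∷ a Y t t z a∉Y
        (λ a∉z _ _ → acceptsTerm-∷-nonhead a t z a∉z (∉ᵇ⇒¬isHead a t a∉t))) (allLists n L)))
      (ih (a ∷ Y) t (uniq-∷Y a a∉Y) uniq-t (cong₂ _∧_ (cong not a∉t) t-avoids-Y) (len-∷Y a))

    accepts-after-head : (a : Fin n) (t z : List (Fin n)) → length z ≡ L → a ∈ᵇ Y ≡ false →
      uniqueᵇ (a ∷ t) ≡ true → disjointᵇ (a ∷ t) Y ≡ true →
      a ∈ᵇ z ≡ false → uniqueᵇ z ≡ true → disjointᵇ z Y ≡ true →
      acceptsTerm (a ∷ t) (a ∷ z) ≡ acceptsTerm t z
    accepts-after-head a [] z _ _ _ _ _ _ _ = refl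
    accepts-after-head a (j ∷ r) z ∣z∣≡L a∉Y uniq-at at-avoids-Y a∉z uniq-z z-avoids-Y =
      acceptsTerm-∷-head a j r z a∉z j≢a j∈z
      where
      j≢a : does (j ≟ a) ≡ false
      j≢a = ∨-conicalˡ _ _ (uniqueᵇ-∷⇒∉ a (j ∷ r) uniq-at)
      j∉Y : j ∈ᵇ Y ≡ false
      j∉Y = disjointᵇ⇒∉ˡ (a ∷ j ∷ r) Y j at-avoids-Y
        (trans (cong (does (a ≟ j) ∨_) (∈ᵇ-head j r)) (∨-zeroʳ _))
      -- z fills all positions not taken by a ∷ Y, so it contains the next element j of the term.
      j∈z : j ∈ᵇ z ≡ true
      j∈z = ∉ᵇ⇒∈ᵇ-complement (a ∷ Y) z j (uniq-∷Y a a∉Y) uniq-z (cong₂ _∧_ (cong not a∉z) z-avoids-Y)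
        (trans (cong (suc (length Y) +_) ∣z∣≡L) (len-∷Y a)) (cong₂ _∨_ (trans (≟-sym a j) j≢a) j∉Y)

    #placedFirst-head : (a : Fin n) (t : Term n) → uniqueᵇ (a ∷ t) ≡ true → disjointᵇ (a ∷ t) Y ≡ true →
      a ∈ᵇ Y ≡ false → length (a ∷ t) ! * #placedFirst (a ∷ t) a ≡ length (a ∷ t) * L !
    #placedFirst-head a t uniq-at at-avoids-Y a∉Y = begin
      (suc (length t) * length t !) * #placedFirst (a ∷ t) a
        ≡⟨ *-assoc (suc (length t)) (length t !) _ ⟩
      suc (length t) * (length t ! * #placedFirst (a ∷ t) a)
        ≡⟨ cong (λ c → suc (length t) * (length t ! * c)) (count-allLists-cong L placing) ⟩
      suc (length t) * (length t ! * #acceptedAvoiding (a ∷ Y) L t)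
        ≡⟨ cong (suc (length t) *_)
             (ih (a ∷ Y) t (uniq-∷Y a a∉Y) (∧-conicalʳ _ _ uniq-at) t-avoids-aY (len-∷Y a)) ⟩
      suc (length t) * L !
        ∎
      where
      open ≡-Reasoning
      t-avoids-aY : disjointᵇ t (a ∷ Y) ≡ true
      t-avoids-aY = cong₂ _∧_ (cong not (uniqueᵇ-∷⇒∉ a t uniq-at))
        (trans (sym (disjointᵇ-∷ˡ-∉ a t Y a∉Y)) at-avoids-Y)
      placing : ∀ z → length z ≡ L →
        acceptedAvoidingᵇ Y (a ∷ t) (a ∷ z) ≡ acceptedAvoidingᵇ (a ∷ Y) t z
      placing z ∣z∣≡L = acceptedAvoidingᵇ-∷ a Y (a ∷ t) t z a∉Y
        (accepts-after-head a t z ∣z∣≡L a∉Y uniq-at at-avoids-Y)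

    #placedFirst-∉ : (a : Fin n) (t : Term n) → uniqueᵇ t ≡ true → disjointᵇ t Y ≡ true →
      a ∈ᵇ Y ≡ false →
      length t ! * #placedFirst t a ≡ 𝟙 (isHead a t) * (length t * L !) + 𝟙 (not (a ∈ᵇ t)) * L !
    #placedFirst-∉ a [] uniq-t t-avoids-Y a∉Y =
      trans (#placedFirst-fresh a [] uniq-t t-avoids-Y a∉Y refl) (sym (+-identityʳ _))
    #placedFirst-∉ a (h ∷ t) uniq-t t-avoids-Y a∉Y with does (h ≟ a) in h≟a
    ... | true with refl ← ≟⇒≡ {h} {a} h≟a =
      trans (#placedFirst-head a t uniq-t t-avoids-Y a∉Y) (sym (trans (+-identityʳ _) (+-identityʳ _)))
    ... | false with a ∈ᵇ t in a∈t
    ...   | true = #placedFirst-tail a h t a∉Y h≟a a∈t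
    ...   | false =
      trans (#placedFirst-fresh a (h ∷ t) uniq-t t-avoids-Y a∉Y (cong₂ _∨_ h≟a a∈t))
            (sym (+-identityʳ _))

    #placedFirst≡ : (t : Term n) → uniqueᵇ t ≡ true → disjointᵇ t Y ≡ true → (a : Fin n) →
      length t ! * #placedFirst t a
        ≡ 𝟙 (isHead a t) * (length t * L !) + 𝟙 (not (a ∈ᵇ Y ∨ a ∈ᵇ t)) * L !
    #placedFirst≡ t uniq-t t-avoids-Y a with a ∈ᵇ Y in a∈Y
    ... | true rewrite ∉ᵇ⇒¬isHead a t (disjointᵇ⇒∉ʳ t Y a t-avoids-Y a∈Y) =
      #placedFirst-∈ a t a∈Y
    ... | false = #placedFirst-∉ a t uniq-t t-avoids-Y a∈Y

  count-isHead-allFin-* : (t : List (Fin n)) (c : ℕ) →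
    count (λ a → isHead a t) (allFin n) * (length t * c) ≡ length t * c
  count-isHead-allFin-* [] c = cong (_* 0) (count-none (λ _ → refl) (allFin n))
  count-isHead-allFin-* (h ∷ t) c = trans (cong (_* (length (h ∷ t) * c)) (count-≟-allFin h)) (*-identityˡ _)

  sum-first-element-contributions : (Y t : List (Fin n)) (L : ℕ) → uniqueᵇ Y ≡ true → uniqueᵇ t ≡ true →
    disjointᵇ t Y ≡ true → length Y + suc L ≡ n →
    sumℕ (map (λ a → 𝟙 (isHead a t) * (length t * L !) + 𝟙 (not (a ∈ᵇ Y ∨ a ∈ᵇ t)) * L !) (allFin n))
      ≡ suc L !
  sum-first-element-contributions Y t L uniq-Y uniq-t t-avoids-Y len = begin
    sumℕ (map (λ a → 𝟙 (isHead a t) * (length t * L !) + 𝟙 (fresh a) * L !) (allFin n))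
      ≡⟨ sum-map-+ (λ a → 𝟙 (isHead a t) * (length t * L !)) (λ a → 𝟙 (fresh a) * L !) (allFin n) ⟩
    sumℕ (map (λ a → 𝟙 (isHead a t) * (length t * L !)) (allFin n))
      + sumℕ (map (λ a → 𝟙 (fresh a) * L !) (allFin n))
      ≡⟨ cong₂ _+_ (*-distribʳ-sum-map (length t * L !) (λ a → 𝟙 (isHead a t)) (allFin n))
                   (*-distribʳ-sum-map (L !) (𝟙 ∘ fresh) (allFin n)) ⟨
    count (λ a → isHead a t) (allFin n) * (length t * L !) + #fresh * L !
      ≡⟨ cong (_+ #fresh * L !) (count-isHead-allFin-* t (L !)) ⟩
    length t * L ! + #fresh * L !
      ≡⟨ *-distribʳ-+ (L !) (length t) #fresh ⟨
    (length t + #fresh) * L !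
      ≡⟨ cong (_* L !) length-t+#fresh ⟩
    suc L * L !
      ∎
    where
    open ≡-Reasoning
    fresh : Fin n → Bool
    fresh a = not (a ∈ᵇ Y ∨ a ∈ᵇ t)
    #fresh : ℕ
    #fresh = count fresh (allFin n)
    length-t+#fresh : length t + #fresh ≡ suc L
    length-t+#fresh = +-cancelˡ-≡ (length Y) _ _ (trans (x∙yz≈z∙xy (length Y) (length t) #fresh)
      (trans (count-∉ᵇ-∨-allFin+length Y t uniq-Y uniq-t t-avoids-Y) (sym len)))

  arrangementCount : ∀ L → ArrangementCount L
  arrangementCount zero Y [] _ _ _ _ rewrite disjointᵇ-[]ˡ Y = refl
  arrangementCount zero Y (h ∷ t) uniq-Y uniq-t t-avoids-Y len =
    contradiction (+-cancelˡ-≤ (length Y) _ _ (subst (length Y + suc (length t) ≤_) (sym len)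
      (length+length≤n Y (h ∷ t) uniq-Y uniq-t t-avoids-Y))) λ ()
  arrangementCount (suc L) Y t uniq-Y uniq-t t-avoids-Y len = begin
    length t ! * #acceptedAvoiding Y (suc L) t
      ≡⟨ cong (length t ! *_) (count-allLists-suc (acceptedAvoidingᵇ Y t) L) ⟩
    length t ! * sumℕ (map (#placedFirst t) (allFin n))
      ≡⟨ *-distribˡ-sum-map (length t !) (#placedFirst t) (allFin n) ⟩
    sumℕ (map (λ a → length t ! * #placedFirst t a) (allFin n))
      ≡⟨ sum-map-cong (#placedFirst≡ t uniq-t t-avoids-Y) (allFin n) ⟩
    sumℕ (map (λ a → 𝟙 (isHead a t) * (length t * L !) + 𝟙 (not (a ∈ᵇ Y ∨ a ∈ᵇ t)) * L !) (allFin n))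
      ≡⟨ sum-first-element-contributions Y t L uniq-Y uniq-t t-avoids-Y len ⟩
    suc L !
      ∎
    where
    open ≡-Reasoning
    open FirstElement (arrangementCount L) Y uniq-Y len

  count-Ord : (p : Order n → Bool) → count p (Ord n) ≡ count (λ z → uniqueᵇ z ∧ p z) (allLists n n)
  count-Ord p = count-filter (unique? _≟_) p (allLists n n)

  length-Ord : length (Ord n) ≡ n !
  length-Ord = begin
    length (Ord n)
      ≡⟨ length-filter≡count (unique? _≟_) (allLists n n) ⟩
    count uniqueᵇ (allLists n n)
      ≡⟨ count-cong (λ z → sym (∧-identityʳ (uniqueᵇ z))) (allLists n n) ⟩
    #acceptedAvoiding [] n []
      ≡⟨ +-identityʳ _ ⟨
    0 ! * #acceptedAvoiding [] n []
      ≡⟨ arrangementCount n [] [] refl refl refl refl ⟩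
    n !
      ∎
    where open ≡-Reasoning

  k!*#accepting≡n! : (k : ℕ) (t : Term n) → length t ≡ k → Unique t →
    k ! * count (acceptsTerm t) (Ord n) ≡ n !
  k!*#accepting≡n! _ t refl uniq = trans (cong (length t ! *_) (count-Ord (acceptsTerm t)))
    (arrangementCount n [] t refl (dec-true (unique? _≟_ t) uniq) refl refl)

  k!*sum-numAccepting≡length*n! : (k : ℕ) (N : DNF n) → All (λ t → length t ≡ k × Unique t) N →
    k ! * sumℕ (map (numAccepting N) (Ord n)) ≡ length N * n !
  k!*sum-numAccepting≡length*n! k N terms = begin
    k ! * sumℕ (map (numAccepting N) (Ord n))
      ≡⟨ cong (k ! *_) (sum-map-cong (λ z → length-filterᵇ (λ t → acceptsTerm t z) N) (Ord n)) ⟩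
    k ! * sumℕ (map (λ z → count (λ t → acceptsTerm t z) N) (Ord n))
      ≡⟨ cong (k ! *_) (sum-map-swap (λ z t → 𝟙 (acceptsTerm t z)) (Ord n) N) ⟩
    k ! * sumℕ (map (λ t → count (acceptsTerm t) (Ord n)) N)
      ≡⟨ *-sum-map-uniform (k !) (n !) _ N
           (All.map (λ {t} (∣t∣≡k , uniq) → k!*#accepting≡n! k t ∣t∣≡k uniq) terms) ⟩
    length N * n !
      ∎
    where open ≡-Reasoning

  sum-numAccepting+length-rejected : (N : DNF n) →
    sumℕ (map (numAccepting N) (Ord n)) + length (rejected N) ≡ n ! + weightedSum N
  sum-numAccepting+length-rejected N = begin
    sumℕ (map (numAccepting N) (Ord n)) + length (rejected N)
      ≡⟨ cong (sumℕ (map (numAccepting N) (Ord n)) +_) length-rejected ⟩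
    sumℕ (map (numAccepting N) (Ord n)) + count (λ z → numAccepting N z ≡ᵇ 0) (Ord n)
      ≡⟨ sum+zeros≡length+excess (numAccepting N) (length N) (Ord n) (λ z → length-filter _ N) ⟩
    length (Ord n) + excess
      ≡⟨ cong₂ _+_ length-Ord (sym weightedSum≡excess) ⟩
    n ! + weightedSum N
      ∎
    where
    open ≡-Reasoning
    excess : ℕ
    excess =
      sumℕ (map (λ i → (i ∸ 1) * count (λ z → numAccepting N z ≡ᵇ i) (Ord n)) (upTo (suc (length N))))
    length-rejected : length (rejected N) ≡ count (λ z → numAccepting N z ≡ᵇ 0) (Ord n)
    length-rejected = trans (length-filterᵇ _ (Ord n))
      (count-cong (λ z → not-any≡length-filterᵇ≡ᵇ0 (λ t → acceptsTerm t z) N) (Ord n))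
    weightedSum≡excess : weightedSum N ≡ excess
    weightedSum≡excess = trans (sum-drop-2-upTo (λ i → length (S N i)) (length N))
      (sum-map-cong (λ i → cong ((i ∸ 1) *_) (length-filterᵇ _ (Ord n))) (upTo (suc (length N))))

-- The sign of the pseudo-expectation

-- `+_` is imported only here, since unqualified it clashes with the sections (m +_) used above.
module _ where

  open import Data.Integer using (+_; -[1+_])

  sumℤ-map-pred : (f : A → ℕ) (xs : List A) →
    sumℤ (map (λ a → + f a ℤ.- 1ℤ) xs) ≡ + sumℕ (map f xs) ℤ.- + length xs
  sumℤ-map-pred f [] = refl
  sumℤ-map-pred f (x ∷ xs) = begin
    (+ f x ℤ.- 1ℤ) ℤ.+ sumℤ (map (λ a → + f a ℤ.- 1ℤ) xs)
      ≡⟨ cong (λ s → (+ f x ℤ.- 1ℤ) ℤ.+ s) (sumℤ-map-pred f xs) ⟩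
    (+ f x ℤ.- 1ℤ) ℤ.+ (+ sumℕ (map f xs) ℤ.- + length xs)
      ≡⟨ rearrange (+ f x) (+ sumℕ (map f xs)) (+ length xs) ⟩
    (+ f x ℤ.+ + sumℕ (map f xs)) ℤ.- (1ℤ ℤ.+ + length xs)
      ≡⟨ cong₂ ℤ._-_ (ℤ.pos-+ (f x) _) (ℤ.pos-+ 1 (length xs)) ⟨
    + (f x + sumℕ (map f xs)) ℤ.- + suc (length xs)
      ∎
    where
    open ≡-Reasoning
    rearrange : ∀ a s l → (a ℤ.- 1ℤ) ℤ.+ (s ℤ.- l) ≡ (a ℤ.+ s) ℤ.- (1ℤ ℤ.+ l)
    rearrange = solve-∀

  0≤i/n⇔0≤i : (i : ℤ) (d : ℕ) → 0ℚ ℚ.≤ i ℚ./ suc d ⇔ 0ℤ ℤ.≤ i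
  0≤i/n⇔0≤i (+ m) d =
    mk⇔ (λ _ → +≤+ z≤n) (λ _ → ℚ.nonNegative⁻¹ _ {{ℚ.normalize-nonNeg m (suc d)}})
  0≤i/n⇔0≤i -[1+ m ] d =
    mk⇔ (λ 0≤i/n → contradiction (ℚ.≤-<-trans 0≤i/n negative) (ℚ.<-irrefl refl)) λ ()
    where
    negative : -[1+ m ] ℚ./ suc d ℚ.< 0ℚ
    negative = ℚ.negative⁻¹ _ {{ℚ.neg-pos {normalize (suc m) (suc d)} (ℚ.normalize-pos (suc m) (suc d))}}

  0≤m-n⇔n≤m : (m k : ℕ) → 0ℤ ℤ.≤ + m ℤ.- + k ⇔ k ≤ m
  0≤m-n⇔n≤m m k = mk⇔ (ℤ.drop‿+≤+ ∘ ℤ.0≤i-j⇒j≤i) (ℤ.i≤j⇒0≤j-i ∘ +≤+)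

  0≤avg⇔ : (vs : List ℤ) (m k : ℕ) → 1 ≤ length vs → sumℤ vs ≡ + m ℤ.- + k →
    0ℚ ℚ.≤ avg vs ⇔ k ≤ m
  0≤avg⇔ (v ∷ vs) m k _ sum≡ = subst (λ i → 0ℚ ℚ.≤ i ℚ./ suc (length vs) ⇔ k ≤ m) (sym sum≡)
    (0≤m-n⇔n≤m m k ⇔-∘ 0≤i/n⇔0≤i (+ m ℤ.- + k) (length vs))

  module _ {n : ℕ} where

    termPoly≡𝟙 : (t : Term n) (z : Order n) → termPoly t z ≡ + 𝟙 (acceptsTerm t z)
    termPoly≡𝟙 [] z = refl
    termPoly≡𝟙 (a ∷ t) z = go a t
      where
      x*𝟙 : (c b : Bool) → (if c then 1ℤ else 0ℤ) ℤ.* + 𝟙 b ≡ + 𝟙 (c ∧ b)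
      x*𝟙 true b = ℤ.*-identityˡ (+ 𝟙 b)
      x*𝟙 false b = ℤ.*-zeroˡ (+ 𝟙 b)
      go : (a : Fin n) (t : Term n) → termPoly (a ∷ t) z ≡ + 𝟙 (acceptsTerm (a ∷ t) z)
      go a [] = refl
      go a (b ∷ t) = trans (cong (x a b z ℤ.*_) (go b t)) (x*𝟙 (precedes a b z) _)

    sum-termPoly : (N : DNF n) (z : Order n) →
      sumℤ (map (λ t → termPoly t z) N) ≡ + count (λ t → acceptsTerm t z) N
    sum-termPoly [] z = refl
    sum-termPoly (t ∷ N) z = trans (cong₂ ℤ._+_ (termPoly≡𝟙 t z) (sum-termPoly N z))
      (sym (ℤ.pos-+ (𝟙 (acceptsTerm t z)) _))

    sum-dnfPoly : (N : DNF n) (O : List (Order n)) →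
      sumℤ (map (dnfPoly N) O) ≡ + sumℕ (map (numAccepting N) O) ℤ.- + length O
    sum-dnfPoly N O = trans
      (cong sumℤ (map-cong (λ z → cong (ℤ._- 1ℤ) (trans (sum-termPoly N z)
        (cong +_ (sym (length-filterᵇ (λ t → acceptsTerm t z) N))))) O))
      (sumℤ-map-pred (numAccepting N) O)

    0≤Ẽ[dnfPoly]⇔ : (N : DNF n) →
      0ℚ ℚ.≤ Ẽ (dnfPoly N) ⇔ n ! ≤ sumℕ (map (numAccepting N) (Ord n))
    0≤Ẽ[dnfPoly]⇔ N =
      subst (λ c → 0ℚ ℚ.≤ Ẽ (dnfPoly N) ⇔ c ≤ sumℕ (map (numAccepting N) (Ord n))) (length-Ord {n})
        (0≤avg⇔ (map (dnfPoly N) (Ord n)) _ _ nonempty (sum-dnfPoly N (Ord n)))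
      where
      nonempty : 1 ≤ length (map (dnfPoly N) (Ord n))
      nonempty = subst (1 ≤_) (sym (trans (length-map (dnfPoly N) (Ord n)) (length-Ord {n}))) (1≤n! n)

*-≡⇒≤⇔≤ : (a b c d : ℕ) .{{_ : NonZero c}} .{{_ : NonZero d}} → c * a ≡ b * d →
  (d ≤ a ⇔ c ≤ b)
*-≡⇒≤⇔≤ a b c d ca≡bd = mk⇔
  (λ d≤a → *-cancelʳ-≤ c b d (subst (c * d ≤_) ca≡bd (*-monoʳ-≤ c d≤a)))
  (λ c≤b → *-cancelˡ-≤ c (subst (c * d ≤_) (sym ca≡bd) (*-monoˡ-≤ d c≤b)))

+-≡⇒≤⇔≤ : (a r b w : ℕ) → a + r ≡ b + w → (b ≤ a ⇔ r ≤ w)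
+-≡⇒≤⇔≤ a r b w ar≡bw = mk⇔
  (λ b≤a → +-cancelˡ-≤ b r w (subst (b + r ≤_) ar≡bw (+-monoˡ-≤ r b≤a)))
  (λ r≤w → +-cancelʳ-≤ r b a (subst (b + r ≤_) (sym ar≡bw) (+-monoʳ-≤ b r≤w)))

lemma4p6 : (m k : ℕ) (N : DNF (suc m)) → Normalized m k N → Implies (M₁ m) N →
    ((0ℚ ℚ.≤ Ẽ (dnfPoly N)) ⇔ (k ! ≤ length N))
    × ((0ℚ ℚ.≤ Ẽ (dnfPoly N)) ⇔ (length (rejected N) ≤ weightedSum N))
lemma4p6 m k N (_ , _ , terms) _ =
  *-≡⇒≤⇔≤ _ (length N) (k !) (suc m !) {{k !≢0}} {{suc m !≢0}}
    (k!*sum-numAccepting≡length*n! k N (All.map (λ (∣t∣≡k , uniq , _) → ∣t∣≡k , uniq) terms))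
    ⇔-∘ 0≤Ẽ[dnfPoly]⇔ N
  , +-≡⇒≤⇔≤ _ _ _ _ (sum-numAccepting+length-rejected N) ⇔-∘ 0≤Ẽ[dnfPoly]⇔ N
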